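{- Let $\mathbf L=(L,\vee,\wedge,0,1)$ be a bounded lattice, $a,b\in L$ with $a\leq b$, $x\in[a,b]$, let $y$ be a complement of $x$ (i.e. $x\vee y=1$, $x\wedge y=0$), and put $e:=(a\vee y)\wedge b$ and $f:=a\vee(y\wedge b)$. Then $f\leq e$, and the following are equivalent: (i) $e,f\in R(a,b,x)$; (ii) $(a,y,x)$ and $(x,y,b)$ are modular triples.
   Context: For a lattice and elements $a\leq b$, $x\in[a,b]$, an element $z\in[a,b]$ is a relative complement of $x$ in $[a,b]$ if $x\vee z=b$ and $x\wedge z=a$; $R(a,b,x)$ denotes the set of all such relative complements. A triple $(p,q,r)$ of elements of a lattice is called modular if $p\leq r$ and $(p\vee q)\wedge r=p\vee(q\wedge r)$. -}

module Defs where

open import Level using (Level)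
open import Data.Product using (_×_)
open import Relation.Binary.Lattice.Bundles using (BoundedLattice)

module _ {c ℓ₁ ℓ₂ : Level} (L : BoundedLattice c ℓ₁ ℓ₂) where
  open BoundedLattice L

  InInterval : Carrier → Carrier → Carrier → Set ℓ₂
  InInterval a b z = (a ≤ z) × (z ≤ b)

  InR : Carrier → Carrier → Carrier → Carrier → Set (ℓ₁ Level.⊔ ℓ₂)
  InR a b x z = InInterval a b z × ((x ∨ z) ≈ b) × ((x ∧ z) ≈ a)

  ModularTriple : Carrier → Carrier → Carrier → Set (ℓ₁ Level.⊔ ℓ₂)
  ModularTriple p q r = (p ≤ r) × (((p ∨ q) ∧ r) ≈ (p ∨ (q ∧ r)))

  IsComplement : Carrier → Carrier → Set ℓ₁
  IsComplement x y = ((x ∨ y) ≈ ⊤) × ((x ∧ y) ≈ ⊥)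

module Submission where

open import Defs
open import Level using (Level)
open import Data.Product using (_×_; _,_)
open import Data.Product.Function.NonDependent.Propositional using (_×-⇔_)
open import Function.Bundles using (_⇔_; mk⇔)
open import Function.Construct.Composition using (_⇔-∘_)
open import Function.Construct.Symmetry using (⇔-sym)
open import Relation.Binary.Lattice.Bundles using (Lattice; BoundedLattice)
import Relation.Binary.Lattice.Properties.JoinSemilattice as JoinProperties
import Relation.Binary.Lattice.Properties.MeetSemilattice as MeetProperties

-- Since f ≤ e, x ∧ f ≤ x ∧ e and x ∨ f ≤ x ∨ e, so both are relative complements of x
-- iff x ∧ e = a and x ∨ f = b. As x ∈ [a,b], these are (a ∨ y) ∧ x = a and
-- x ∨ (y ∧ b) = b; and because x ∧ y = 0 and x ∨ y = 1, the right-hand sides a and b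
-- coincide with a ∨ (y ∧ x) and (x ∨ y) ∧ b, which are the two modular triple equations.

module LatticeProperties {c ℓ₁ ℓ₂ : Level} (L : Lattice c ℓ₁ ℓ₂) where
  open Lattice L

  modularInequality : ∀ {a b y} → a ≤ b → a ∨ (y ∧ b) ≤ (a ∨ y) ∧ b
  modularInequality {a} {b} {y} a≤b = ∨-least
    (∧-greatest (x≤x∨y a y) a≤b)
    (∧-greatest (trans (x∧y≤x y b) (y≤x∨y a y)) (x∧y≤y y b))

  x≤z⇒x∧[y∧z]≈y∧x : ∀ {x y z} → x ≤ z → x ∧ (y ∧ z) ≈ y ∧ x
  x≤z⇒x∧[y∧z]≈y∧x {x} {y} {z} x≤z = antisym
    (∧-greatest (trans (x∧y≤y x (y ∧ z)) (x∧y≤x y z)) (x∧y≤x x (y ∧ z)))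
    (∧-greatest (x∧y≤y y x) (∧-greatest (x∧y≤x y x) (trans (x∧y≤y y x) x≤z)))

  z≤x⇒x∨[z∨y]≈x∨y : ∀ {x y z} → z ≤ x → x ∨ (z ∨ y) ≈ x ∨ y
  z≤x⇒x∨[z∨y]≈x∨y {x} {y} {z} z≤x = antisym
    (∨-least (x≤x∨y x y) (∨-least (trans z≤x (x≤x∨y x y)) (y≤x∨y x y)))
    (∨-least (x≤x∨y x (z ∨ y)) (trans (y≤x∨y z y) (y≤x∨y x (z ∨ y))))

module BoundedLatticeProperties {c ℓ₁ ℓ₂ : Level} (L : BoundedLattice c ℓ₁ ℓ₂) where
  open BoundedLattice L
  open LatticeProperties lattice public
  open JoinProperties joinSemilattice using (∨-monotonic)
  open MeetProperties meetSemilattice using (∧-monotonic; y≤x⇒x∧y≈y)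

  ≈-respˡ-⇔ : ∀ {p q r} → p ≈ q → (p ≈ r) ⇔ (q ≈ r)
  ≈-respˡ-⇔ p≈q = mk⇔ (Eq.trans (Eq.sym p≈q)) (Eq.trans p≈q)

  modularTriple⇔meet : ∀ {p q r} → p ≤ r → q ∧ r ≤ p →
                       ModularTriple L p q r ⇔ ((p ∨ q) ∧ r ≈ p)
  modularTriple⇔meet {p} {q} {r} p≤r q∧r≤p =
    mk⇔ (λ (_ , modular) → Eq.trans modular p∨[q∧r]≈p)
        (λ meet≈p → p≤r , Eq.trans meet≈p (Eq.sym p∨[q∧r]≈p))
    where
    p∨[q∧r]≈p : p ∨ (q ∧ r) ≈ p
    p∨[q∧r]≈p = antisym (∨-least refl q∧r≤p) (x≤x∨y p (q ∧ r))

  modularTriple⇔join : ∀ {p q r} → p ≤ r → r ≤ p ∨ q →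
                       ModularTriple L p q r ⇔ (p ∨ (q ∧ r) ≈ r)
  modularTriple⇔join {p} {q} {r} p≤r r≤p∨q =
    mk⇔ (λ (_ , modular) → Eq.trans (Eq.sym modular) [p∨q]∧r≈r)
        (λ join≈r → p≤r , Eq.trans [p∨q]∧r≈r (Eq.sym join≈r))
    where
    [p∨q]∧r≈r : (p ∨ q) ∧ r ≈ r
    [p∨q]∧r≈r = y≤x⇒x∧y≈y r≤p∨q

  relativeComplements⇔ : ∀ {a b x e f} → a ≤ f → f ≤ e → e ≤ b → InInterval L a b x →
                         (InR L a b x e × InR L a b x f) ⇔ ((x ∧ e ≈ a) × (x ∨ f ≈ b))
  relativeComplements⇔ {a} {b} {x} {e} {f} a≤f f≤e e≤b (a≤x , x≤b) =
    mk⇔ (λ ((_ , _ , x∧e≈a) , (_ , x∨f≈b , _)) → x∧e≈a , x∨f≈b)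
        (λ (x∧e≈a , x∨f≈b) →
          ((trans a≤f f≤e , e≤b) , x∨e≈b x∨f≈b , x∧e≈a) ,
          ((a≤f , trans f≤e e≤b) , x∨f≈b , x∧f≈a x∧e≈a))
    where
    x∨e≈b : x ∨ f ≈ b → x ∨ e ≈ b
    x∨e≈b x∨f≈b = antisym (∨-least x≤b e≤b)
      (trans (reflexive (Eq.sym x∨f≈b)) (∨-monotonic refl f≤e))

    x∧f≈a : x ∧ e ≈ a → x ∧ f ≈ a
    x∧f≈a x∧e≈a = antisym (trans (∧-monotonic refl f≤e) (reflexive x∧e≈a))
      (∧-greatest a≤x a≤f)

theorem2 : {c ℓ₁ ℓ₂ : Level} (L : BoundedLattice c ℓ₁ ℓ₂) →
    let open BoundedLattice L in
    (a b x y : Carrier) → a ≤ b → InInterval L a b x → IsComplement L x y →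
    let e = (a ∨ y) ∧ b
        f = a ∨ (y ∧ b)
    in (f ≤ e) ×
       ((InR L a b x e × InR L a b x f) ⇔ (ModularTriple L a y x × ModularTriple L x y b))
theorem2 L a b x y a≤b (a≤x , x≤b) (x∨y≈⊤ , x∧y≈⊥) =
  f≤e ,
  (⇔-sym (modularTriple⇔meet a≤x y∧x≤a ×-⇔ modularTriple⇔join x≤b b≤x∨y)
    ⇔-∘ (≈-respˡ-⇔ (x≤z⇒x∧[y∧z]≈y∧x x≤b) ×-⇔ ≈-respˡ-⇔ (z≤x⇒x∨[z∨y]≈x∨y a≤x)))
    ⇔-∘ relativeComplements⇔ (x≤x∨y a (y ∧ b)) f≤e (x∧y≤y (a ∨ y) b) (a≤x , x≤b)
  where
  open BoundedLattice L
  open BoundedLatticeProperties L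

  f≤e : a ∨ (y ∧ b) ≤ (a ∨ y) ∧ b
  f≤e = modularInequality a≤b

  y∧x≤a : y ∧ x ≤ a
  y∧x≤a = trans (∧-greatest (x∧y≤y y x) (x∧y≤x y x)) (trans (reflexive x∧y≈⊥) (minimum a))

  b≤x∨y : b ≤ x ∨ y
  b≤x∨y = trans (maximum b) (reflexive (Eq.sym x∨y≈⊤))
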